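{- Let $N$ and $d$ be positive integers, let $k = \gcd(d,N)$, and let $A \subseteq \mathbb{Z}_N$ be $\{x,dx\}$-free. Then $$|A| \leqslant \frac{k}{k+1}N.$$
   Context: A set $A \subseteq \mathbb{Z}_N$ is $\{x,dx\}$-free if there is no $x \in \mathbb{Z}_N$ with both $x \in A$ and $dx \in A$ (multiplication taken modulo $N$). -}

module Defs where

open import Data.Nat using (ℕ; suc; _*_; NonZero)
open import Data.Nat.DivMod using (_mod_)
open import Data.Fin using (Fin; toℕ)
open import Data.Fin.Subset using (Subset; _∈_)
open import Data.Product using (_×_)
open import Relation.Nullary using (¬_)

-- Z_N is represented by Fin N (residues 0..N-1); requires N nonzero.
-- scale d x = d·x in Z_N (multiplication modulo N).
scale : (N : ℕ) → .{{_ : NonZero N}} → ℕ → Fin N → Fin N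
scale N d x = (d * toℕ x) mod N

XDXFree : (N : ℕ) → .{{_ : NonZero N}} → ℕ → Subset N → Set
XDXFree N d A = ∀ (x : Fin N) → ¬ (x ∈ A × scale N d x ∈ A)

{-# OPTIONS --safe #-}
module Submission where

-- Write N = m k and d = d′ k with k = gcd d N, so that d′ is a unit modulo m, and let b be the
-- number of multiples of k in A. Since x and d x are never both in A, |A| + #{x : d x ∈ A} ≤ N,
-- and as x ↦ d x maps ℤ_N k-to-one onto the multiples of k, #{x : d x ∈ A} = k b. On the other
-- hand only N − m elements of ℤ_N are not multiples of k, so |A| ≤ b + (N − m). Adding k times
-- the second inequality to the first gives (k + 1) |A| ≤ k N.

open import Defs
open import Data.Nat using (ℕ; suc; _*_; _+_; _≤_; NonZero)
open import Data.Nat.GCD using (gcd)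
open import Data.Fin.Subset using (Subset; ∣_∣)

open import Data.Bool using (Bool; true; false)
open import Data.Empty using (⊥; ⊥-elim)
open import Data.Fin as Fin using (Fin; toℕ; fromℕ<)
open import Data.Fin.Permutation using (Permutation; permutation; _⟨$⟩ʳ_)
open import Data.Fin.Properties using (toℕ-injective; toℕ-fromℕ<; toℕ<n)
open import Data.Nat using (zero; _<_; _%_; _/_; z≤n; s≤s; ≢-nonZero; ≢-nonZero⁻¹)
open import Data.Nat.Coprimality using (Coprime; coprime-/gcd; coprime-Bézout)
open import Data.Nat.DivMod
open import Data.Nat.GCD using (gcd[m,n]∣m; gcd[m,n]∣n; gcd[m,n]≢0; n/gcd[m,n]≢0; module Bézout)
open import Data.Nat.Properties
open import Data.Nat.Tactic.RingSolver using (solve-∀)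
open import Data.Product using (∃; _,_)
open import Data.Sum using (inj₂)
open import Data.Vec using ([]; _∷_; lookup)
open import Data.Vec.Properties using (lookup⇒[]=)
open import Function using (_∘_; const)
open import Relation.Binary.PropositionalEquality
open import Algebra.Properties.CommutativeMonoid.Sum +-0-commutativeMonoid using (sum; sum-permute; sum-cong-≗)
open import Algebra.Properties.CommutativeSemigroup +-commutativeSemigroup using (interchange)

sumTo : ℕ → (ℕ → ℕ) → ℕ
sumTo zero    f = 0
sumTo (suc n) f = f 0 + sumTo n (f ∘ suc)

sumTo-cong : ∀ n {f g : ℕ → ℕ} → (∀ {x} → x < n → f x ≡ g x) → sumTo n f ≡ sumTo n g
sumTo-cong zero    eq = refl
sumTo-cong (suc n) eq = cong₂ _+_ (eq (s≤s z≤n)) (sumTo-cong n (eq ∘ s≤s))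

sumTo-mono-≤ : ∀ n {f g : ℕ → ℕ} → (∀ {x} → x < n → f x ≤ g x) → sumTo n f ≤ sumTo n g
sumTo-mono-≤ zero    le = z≤n
sumTo-mono-≤ (suc n) le = +-mono-≤ (le (s≤s z≤n)) (sumTo-mono-≤ n (le ∘ s≤s))

sumTo-distrib-+ : ∀ n (f g : ℕ → ℕ) → sumTo n (λ x → f x + g x) ≡ sumTo n f + sumTo n g
sumTo-distrib-+ zero    f g = refl
sumTo-distrib-+ (suc n) f g = begin
  f 0 + g 0 + sumTo n (λ x → f (suc x) + g (suc x)) ≡⟨ cong (f 0 + g 0 +_) (sumTo-distrib-+ n _ _) ⟩
  f 0 + g 0 + (sumTo n (f ∘ suc) + sumTo n (g ∘ suc)) ≡⟨ interchange (f 0) (g 0) _ _ ⟩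
  f 0 + sumTo n (f ∘ suc) + (g 0 + sumTo n (g ∘ suc)) ∎
  where open ≡-Reasoning

sumTo-const : ∀ n c → sumTo n (const c) ≡ n * c
sumTo-const zero    c = refl
sumTo-const (suc n) c = cong (c +_) (sumTo-const n c)

sumTo-+ : ∀ m n (f : ℕ → ℕ) → sumTo (m + n) f ≡ sumTo m f + sumTo n (λ x → f (m + x))
sumTo-+ zero    n f = refl
sumTo-+ (suc m) n f = trans (cong (f 0 +_) (sumTo-+ m n (f ∘ suc))) (sym (+-assoc (f 0) _ _))

sumTo-periodic : ∀ k m (f : ℕ → ℕ) → (∀ x → f (m + x) ≡ f x) → sumTo (k * m) f ≡ k * sumTo m f
sumTo-periodic zero    m f per = refl
sumTo-periodic (suc k) m f per = begin
  sumTo (m + k * m) f                             ≡⟨ sumTo-+ m (k * m) f ⟩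
  sumTo m f + sumTo (k * m) (λ x → f (m + x))     ≡⟨ cong (sumTo m f +_) (sumTo-cong (k * m) (λ {x} _ → per x)) ⟩
  sumTo m f + sumTo (k * m) f                     ≡⟨ cong (sumTo m f +_) (sumTo-periodic k m f per) ⟩
  sumTo m f + k * sumTo m f                       ∎
  where open ≡-Reasoning

sumTo-blocks : ∀ m k (f : ℕ → ℕ) → sumTo (m * k) f ≡ sumTo m (λ j → sumTo k (λ r → f (j * k + r)))
sumTo-blocks zero    k f = refl
sumTo-blocks (suc m) k f = begin
  sumTo (k + m * k) f                                              ≡⟨ sumTo-+ k (m * k) f ⟩
  sumTo k f + sumTo (m * k) (λ x → f (k + x))                      ≡⟨ cong (sumTo k f +_) (sumTo-blocks m k (λ x → f (k + x))) ⟩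
  sumTo k f + sumTo m (λ j → sumTo k (λ r → f (k + (j * k + r))))  ≡⟨ cong (sumTo k f +_) (sumTo-cong m (λ {j} _ → sumTo-cong k (λ {r} _ → reassoc j r))) ⟩
  sumTo k f + sumTo m (λ j → sumTo k (λ r → f (k + j * k + r)))    ∎
  where
  open ≡-Reasoning
  reassoc : ∀ j r → f (k + (j * k + r)) ≡ f (k + j * k + r)
  reassoc j r = cong f (sym (+-assoc k (j * k) r))

sum-toℕ≡sumTo : ∀ n (f : ℕ → ℕ) → sum {n} (f ∘ toℕ) ≡ sumTo n f
sum-toℕ≡sumTo zero    f = refl
sum-toℕ≡sumTo (suc n) f = cong (f 0 +_) (sum-toℕ≡sumTo n (f ∘ suc))

boolToℕ : Bool → ℕ
boolToℕ true  = 1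
boolToℕ false = 0

boolToℕ-exclusive : ∀ b c → (b ≡ true → c ≡ true → ⊥) → boolToℕ b + boolToℕ c ≤ 1
boolToℕ-exclusive true  true  excl = ⊥-elim (excl refl refl)
boolToℕ-exclusive true  false excl = ≤-refl
boolToℕ-exclusive false true  excl = ≤-refl
boolToℕ-exclusive false false excl = z≤n

indicator : ∀ {n} → Subset n → ℕ → ℕ
indicator []      x       = 0
indicator (b ∷ A) zero    = boolToℕ b
indicator (b ∷ A) (suc x) = indicator A x

indicator≤1 : ∀ {n} (A : Subset n) x → indicator A x ≤ 1
indicator≤1 []          x       = z≤n
indicator≤1 (true ∷ A)  zero    = ≤-refl
indicator≤1 (false ∷ A) zero    = z≤n
indicator≤1 (b ∷ A)     (suc x) = indicator≤1 A x

indicator-toℕ : ∀ {n} (A : Subset n) (y : Fin n) → indicator A (toℕ y) ≡ boolToℕ (lookup A y)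
indicator-toℕ (b ∷ A) Fin.zero    = refl
indicator-toℕ (b ∷ A) (Fin.suc y) = indicator-toℕ A y

∣A∣≡sumTo-indicator : ∀ {n} (A : Subset n) → ∣ A ∣ ≡ sumTo n (indicator A)
∣A∣≡sumTo-indicator []          = refl
∣A∣≡sumTo-indicator (true ∷ A)  = cong suc (∣A∣≡sumTo-indicator A)
∣A∣≡sumTo-indicator (false ∷ A) = ∣A∣≡sumTo-indicator A

%-absorbʳ-* : ∀ m n d .{{_ : NonZero d}} → (m * (n % d)) % d ≡ (m * n) % d
%-absorbʳ-* m n d = begin
  (m * (n % d)) % d             ≡⟨ %-distribˡ-* m (n % d) d ⟩
  ((m % d) * (n % d % d)) % d   ≡⟨ cong (λ z → ((m % d) * z) % d) (m%n%n≡m%n n d) ⟩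
  ((m % d) * (n % d)) % d       ≡⟨ %-distribˡ-* m n d ⟨
  (m * n) % d                   ∎
  where open ≡-Reasoning

*%-inverse : ∀ m .{{_ : NonZero m}} c e → (e * c) % m ≡ 1 % m →
             ∀ {j} → j < m → (e * ((c * j) % m)) % m ≡ j
*%-inverse m c e ec≡1 {j} j<m = begin
  (e * ((c * j) % m)) % m  ≡⟨ %-absorbʳ-* e (c * j) m ⟩
  (e * (c * j)) % m        ≡⟨ cong (_% m) (*-assoc e c j) ⟨
  (e * c * j) % m          ≡⟨ cong (_% m) (*-comm (e * c) j) ⟩
  (j * (e * c)) % m        ≡⟨ %-absorbʳ-* j (e * c) m ⟨
  (j * ((e * c) % m)) % m  ≡⟨ cong (λ z → (j * z) % m) ec≡1 ⟩
  (j * (1 % m)) % m        ≡⟨ %-absorbʳ-* j 1 m ⟩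
  (j * 1) % m              ≡⟨ cong (_% m) (*-identityʳ j) ⟩
  j % m                    ≡⟨ m<n⇒m%n≡m j<m ⟩
  j                        ∎
  where open ≡-Reasoning

*%-permutation : ∀ m .{{_ : NonZero m}} c e → (e * c) % m ≡ 1 % m → Permutation m m
*%-permutation m c e ec≡1 =
  permutation (multiplyBy c) (multiplyBy e) (cancel c e ce≡1) (cancel e c ec≡1)
  where
  multiplyBy : ℕ → Fin m → Fin m
  multiplyBy a i = (a * toℕ i) mod m
  ce≡1 : (c * e) % m ≡ 1 % m
  ce≡1 = trans (cong (_% m) (*-comm c e)) ec≡1
  cancel : ∀ a b → (a * b) % m ≡ 1 % m → ∀ i → multiplyBy a (multiplyBy b i) ≡ i
  cancel a b ab≡1 i = toℕ-injective (begin
    toℕ ((a * toℕ ((b * toℕ i) mod m)) mod m) ≡⟨ toℕ-fromℕ< (m%n<n _ m) ⟩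
    (a * toℕ ((b * toℕ i) mod m)) % m         ≡⟨ cong (λ z → (a * z) % m) (toℕ-fromℕ< (m%n<n _ m)) ⟩
    (a * ((b * toℕ i) % m)) % m               ≡⟨ *%-inverse m b a ab≡1 (toℕ<n i) ⟩
    toℕ i                                     ∎)
    where open ≡-Reasoning

sumTo-*%-permute : ∀ m .{{_ : NonZero m}} c e → (e * c) % m ≡ 1 % m →
                   ∀ f → sumTo m (λ i → f ((c * i) % m)) ≡ sumTo m f
sumTo-*%-permute m c e ec≡1 f = begin
  sumTo m (λ i → f ((c * i) % m))        ≡⟨ sum-toℕ≡sumTo m _ ⟨
  sum {m} (λ i → f ((c * toℕ i) % m))   ≡⟨ sum-cong-≗ {m} (λ i → cong f (toℕ-fromℕ< (m%n<n (c * toℕ i) m))) ⟨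
  sum {m} (λ i → f (toℕ (π ⟨$⟩ʳ i)))    ≡⟨ sum-permute (f ∘ toℕ) π ⟨
  sum {m} (f ∘ toℕ)                     ≡⟨ sum-toℕ≡sumTo m f ⟩
  sumTo m f                              ∎
  where
  open ≡-Reasoning
  π = *%-permutation m c e ec≡1

coprime⇒*%-inverse : ∀ {c m} .{{_ : NonZero m}} → Coprime c m → ∃ λ e → (e * c) % m ≡ 1 % m
coprime⇒*%-inverse {c} {m@(suc m′)} coprime with coprime-Bézout coprime
... | Bézout.+- x y 1+ym≡xc = x , (begin
  (x * c) % m      ≡⟨ cong (_% m) 1+ym≡xc ⟨
  (1 + y * m) % m  ≡⟨ [m+kn]%n≡m%n 1 y m ⟩
  1 % m            ∎)
  where open ≡-Reasoning
-- In the other case −x is an inverse of c, and m′ * x ≡ −x modulo m.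
... | Bézout.-+ x y 1+xc≡ym = m′ * x , (begin
  (m′ * x * c) % m             ≡⟨ [m+n]%n≡m%n (m′ * x * c) m ⟨
  (m′ * x * c + m) % m         ≡⟨ cong (_% m) (expand m′ x c) ⟩
  (1 + m′ * (1 + x * c)) % m   ≡⟨ cong (λ z → (1 + m′ * z) % m) 1+xc≡ym ⟩
  (1 + m′ * (y * m)) % m       ≡⟨ cong (λ z → (1 + z) % m) (*-assoc m′ y m) ⟨
  (1 + m′ * y * m) % m         ≡⟨ [m+kn]%n≡m%n 1 (m′ * y) m ⟩
  1 % m                        ∎)
  where
  open ≡-Reasoning
  expand : ∀ m′ x c → m′ * x * c + (1 + m′) ≡ 1 + m′ * (1 + x * c)
  expand = solve-∀

sumTo-≤-multiples : ∀ m k′ (f : ℕ → ℕ) → (∀ x → f x ≤ 1) →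
                    sumTo (m * suc k′) f ≤ sumTo m (λ j → f (j * suc k′)) + m * k′
sumTo-≤-multiples m k′ f f≤1 = begin
  sumTo (m * k) f                                 ≡⟨ sumTo-blocks m k f ⟩
  sumTo m (λ j → sumTo k (λ r → f (j * k + r)))   ≤⟨ sumTo-mono-≤ m (λ {j} _ → block≤ j) ⟩
  sumTo m (λ j → f (j * k) + k′)                  ≡⟨ sumTo-distrib-+ m (λ j → f (j * k)) (const k′) ⟩
  sumTo m (λ j → f (j * k)) + sumTo m (const k′)  ≡⟨ cong (sumTo m (λ j → f (j * k)) +_) (sumTo-const m k′) ⟩
  sumTo m (λ j → f (j * k)) + m * k′              ∎
  where
  open ≤-Reasoning
  k = suc k′
  block≤ : ∀ j → sumTo k (λ r → f (j * k + r)) ≤ f (j * k) + k′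
  block≤ j = +-mono-≤ (≤-reflexive (cong f (+-identityʳ (j * k)))) (begin
    sumTo k′ (λ r → f (j * k + suc r))  ≤⟨ sumTo-mono-≤ k′ (λ _ → f≤1 _) ⟩
    sumTo k′ (const 1)                  ≡⟨ sumTo-const k′ 1 ⟩
    k′ * 1                              ≡⟨ *-identityʳ k′ ⟩
    k′                                  ∎)

-- Multiplication by c k, with c a unit modulo m, hits every multiple of k in ℤ_{m k} exactly k times.
sumTo-dilate : ∀ m k .{{_ : NonZero m}} .{{_ : NonZero (m * k)}} c e → (e * c) % m ≡ 1 % m →
               ∀ f → sumTo (m * k) (λ x → f ((c * k * x) % (m * k))) ≡ k * sumTo m (λ j → f (j * k))
sumTo-dilate m k c e ec≡1 f = begin
  sumTo (m * k) (λ x → f ((c * k * x) % (m * k)))  ≡⟨ sumTo-cong (m * k) (λ {x} _ → cong f (reduce x)) ⟩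
  sumTo (m * k) g                                  ≡⟨ cong (λ n → sumTo n g) (*-comm m k) ⟩
  sumTo (k * m) g                                  ≡⟨ sumTo-periodic k m g period ⟩
  k * sumTo m g                                    ≡⟨ cong (k *_) (sumTo-*%-permute m c e ec≡1 (λ j → f (j * k))) ⟩
  k * sumTo m (λ j → f (j * k))                    ∎
  where
  open ≡-Reasoning
  g : ℕ → ℕ
  g x = f (((c * x) % m) * k)
  reduce : ∀ x → (c * k * x) % (m * k) ≡ ((c * x) % m) * k
  reduce x = trans (cong (_% (m * k)) (swap c k x)) (sym (m%n*o≡m*o%[n*o] (c * x) m k))
    where
    swap : ∀ c k x → c * k * x ≡ c * x * k
    swap = solve-∀
  period : ∀ x → g (m + x) ≡ g x
  period x = cong (λ z → f (z * k)) (begin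
    (c * (m + x)) % m      ≡⟨ cong (_% m) (distrib c m x) ⟩
    (c * x + c * m) % m    ≡⟨ [m+kn]%n≡m%n (c * x) c m ⟩
    (c * x) % m            ∎)
    where
    distrib : ∀ c m x → c * (m + x) ≡ c * x + c * m
    distrib = solve-∀

xdxFree⇒indicator-pair≤1 : ∀ {N d} .{{_ : NonZero N}} {A : Subset N} → XDXFree N d A →
                           ∀ {x} → x < N → indicator A x + indicator A ((d * x) % N) ≤ 1
xdxFree⇒indicator-pair≤1 {N} {d} {A} free {x} x<N = begin
  indicator A x + indicator A ((d * x) % N)
    ≡⟨ cong (λ z → indicator A z + indicator A ((d * z) % N)) (toℕ-fromℕ< x<N) ⟨
  indicator A (toℕ y) + indicator A ((d * toℕ y) % N)
    ≡⟨ cong (λ z → indicator A (toℕ y) + indicator A z) (toℕ-fromℕ< (m%n<n (d * toℕ y) N)) ⟨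
  indicator A (toℕ y) + indicator A (toℕ (scale N d y))
    ≡⟨ cong₂ _+_ (indicator-toℕ A y) (indicator-toℕ A (scale N d y)) ⟩
  boolToℕ (lookup A y) + boolToℕ (lookup A (scale N d y))
    ≤⟨ boolToℕ-exclusive _ _ (λ y∈A dy∈A → free y (lookup⇒[]= y A y∈A , lookup⇒[]= _ A dy∈A)) ⟩
  1 ∎
  where
  open ≤-Reasoning
  y = fromℕ< x<N

xdxFree⇒sumTo-pairs≤ : ∀ {N d} .{{_ : NonZero N}} {A : Subset N} → XDXFree N d A →
                       sumTo N (indicator A) + sumTo N (λ x → indicator A ((d * x) % N)) ≤ N
xdxFree⇒sumTo-pairs≤ {N} {d} {A} free = begin
  sumTo N (indicator A) + sumTo N (λ x → indicator A ((d * x) % N))  ≡⟨ sumTo-distrib-+ N _ _ ⟨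
  sumTo N (λ x → indicator A x + indicator A ((d * x) % N))          ≤⟨ sumTo-mono-≤ N (xdxFree⇒indicator-pair≤1 {d = d} free) ⟩
  sumTo N (const 1)                                                  ≡⟨ sumTo-const N 1 ⟩
  N * 1                                                              ≡⟨ *-identityʳ N ⟩
  N                                                                  ∎
  where open ≤-Reasoning

eliminate-bound : ∀ a b m k′ → a ≤ b + m * k′ → a + suc k′ * b ≤ m * suc k′ →
                  a * (suc k′ + 1) ≤ suc k′ * (m * suc k′)
eliminate-bound a b m k′ a≤b+mk′ a+kb≤mk = begin
  a * (k + 1)                ≡⟨ lhs a k′ ⟩
  k * a + a                  ≤⟨ +-monoˡ-≤ a (*-monoʳ-≤ k a≤b+mk′) ⟩
  k * (b + m * k′) + a       ≡⟨ middle a b m k′ ⟩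
  k * m * k′ + (a + k * b)   ≤⟨ +-monoʳ-≤ (k * m * k′) a+kb≤mk ⟩
  k * m * k′ + m * k         ≡⟨ rhs m k′ ⟩
  k * (m * k)                ∎
  where
  open ≤-Reasoning
  k = suc k′
  lhs : ∀ a k′ → a * (suc k′ + 1) ≡ suc k′ * a + a
  lhs = solve-∀
  middle : ∀ a b m k′ → suc k′ * (b + m * k′) + a ≡ suc k′ * m * k′ + (a + suc k′ * b)
  middle = solve-∀
  rhs : ∀ m k′ → suc k′ * m * k′ + m * suc k′ ≡ suc k′ * (m * suc k′)
  rhs = solve-∀

xdxFree-bound : ∀ m k d′ .{{_ : NonZero m}} .{{_ : NonZero k}} {N d} .{{_ : NonZero N}} (A : Subset N) →
                XDXFree N d A → N ≡ m * k → d ≡ d′ * k → Coprime d′ m → ∣ A ∣ * (k + 1) ≤ k * N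
xdxFree-bound m k@(suc k′) d′ A free refl refl coprime with e , ed′≡1 ← coprime⇒*%-inverse coprime = begin
  ∣ A ∣ * (k + 1)        ≡⟨ cong (_* (k + 1)) (∣A∣≡sumTo-indicator A) ⟩
  sumTo N a * (k + 1)    ≤⟨ eliminate-bound (sumTo N a) multiplesInA m k′ fewNmultiplesInA pairs ⟩
  k * N                  ∎
  where
  open ≤-Reasoning
  N = m * k
  a = indicator A
  multiplesInA = sumTo m (λ j → a (j * k))
  fewNmultiplesInA : sumTo N a ≤ multiplesInA + m * k′
  fewNmultiplesInA = sumTo-≤-multiples m k′ a (indicator≤1 A)
  pairs : sumTo N a + k * multiplesInA ≤ N
  pairs = subst (λ s → sumTo N a + s ≤ N) (sumTo-dilate m k d′ e ed′≡1 a) (xdxFree⇒sumTo-pairs≤ {d = d′ * k} free)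

mainTheorem5 : (N d : ℕ) → .{{_ : NonZero N}} → .{{_ : NonZero d}} →
    (A : Subset N) → XDXFree N d A →
    ∣ A ∣ * (gcd d N + 1) ≤ gcd d N * N
mainTheorem5 N d A free =
  xdxFree-bound (N / g) g (d / g) A free (sym (m/n*n≡m (gcd[m,n]∣n d N))) (sym (m/n*n≡m (gcd[m,n]∣m d N)))
    (coprime-/gcd d N)
  where
  g = gcd d N
  instance
    g≢0 : NonZero g
    g≢0 = ≢-nonZero (gcd[m,n]≢0 d N (inj₂ (≢-nonZero⁻¹ N)))
    N/g≢0 : NonZero (N / g)
    N/g≢0 = ≢-nonZero (n/gcd[m,n]≢0 d N)
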